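{- Let $a,b,k$ be integers with $k\ge b>a\ge1$. For $m\ge1$ let $\mathcal{BD}_{a,b,k}(m)$ be the set of partitions $\lambda=(\lambda_1,\dots,\lambda_m)$ with exactly $m$ parts, all congruent to $a$ or $b$ modulo $k$, such that for $1\le i<m$, $\lambda_i-\lambda_{i+1}\ge k$ with strict inequality if $\lambda_i\equiv b\pmod k$, and moreover $\lambda_m\in\{a,b\}$ and, for $1\le i<m$, $\lambda_i-\lambda_{i+1}\le 2k$ with strict inequality if $\lambda_{i+1}\equiv a\pmod k$. For $0\le h\le m-1$ let $\mathcal{BD}_{a,b,k}(m,h,a)$ (resp. $\mathcal{BD}_{a,b,k}(m,h,b)$) be the set of $\lambda\in\mathcal{BD}_{a,b,k}(m)$ with largest part $kh+k(m-1)+a$ (resp. $kh+k(m-1)+b$). Then for $m\ge1$ and $0\le h\le m-1$, \[\sum_{\lambda\in\mathcal{BD}_{a,b,k}(m,h,a)}u^{\ell_a(\lambda)}v^{\ell_b(\lambda)}q^{|\lambda|}=u^{m-h}v^hq^{k\binom m2+k\binom{h+1}2+ma+(b-a)h}{{m-1}\brack h}_k,\] \[\sum_{\lambda\in\mathcal{BD}_{a,b,k}(m,h,b)}u^{\ell_a(\lambda)}v^{\ell_b(\lambda)}q^{|\lambda|}=u^{m-h-1}v^{h+1}q^{k\binom m2+k\binom{h+1}2+ma+(b-a)(h+1)}{{m-1}\brack h}_k.\]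
   Context: A partition is a finite non-increasing sequence of positive integers; $|\lambda|$ is the sum of its parts; $\ell_a(\lambda)$, $\ell_b(\lambda)$ are the numbers of parts congruent to $a$, resp. $b$, modulo $k$. $(x;q)_n=\prod_{i=0}^{n-1}(1-xq^i)$, and ${A\brack B}_k=\frac{(q^k;q^k)_A}{(q^k;q^k)_B(q^k;q^k)_{A-B}}$ for $A\ge B\ge0$, $0$ otherwise. -}

module Defs where

open import Level using (Level)
open import Data.Nat as ℕ using (ℕ; zero; suc; _+_; _*_; _∸_; _≤ᵇ_; _<ᵇ_; _≡ᵇ_; NonZero)
open import Data.Nat.DivMod using (_%_)
open import Data.Bool using (Bool; true; false; _∧_; _∨_; not; if_then_else_)
open import Data.List using (List; []; _∷_; map; concatMap; upTo; length)
open import Algebra.Bundles using (CommutativeRing)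

listsUpTo : ℕ → ℕ → List (List ℕ)
listsUpTo L zero    = [] ∷ []
listsUpTo L (suc m) = concatMap (λ x → map (x ∷_) (listsUpTo L m)) (upTo (suc L))

filterᵇ : {A : Set} → (A → Bool) → List A → List A
filterᵇ p []       = []
filterᵇ p (x ∷ xs) = if p x then x ∷ filterᵇ p xs else filterᵇ p xs

allᵇ : {A : Set} → (A → Bool) → List A → Bool
allᵇ p []       = true
allᵇ p (x ∷ xs) = p x ∧ allᵇ p xs

countᵇ : {A : Set} → (A → Bool) → List A → ℕ
countᵇ p []       = 0
countᵇ p (x ∷ xs) = if p x then suc (countᵇ p xs) else countᵇ p xs

sumℕ : List ℕ → ℕ
sumℕ []       = 0
sumℕ (x ∷ xs) = x + sumℕ xs

-- head of the list equals L (the largest part, partitions listed non-increasingly)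
headIs : ℕ → List ℕ → Bool
headIs L []      = false
headIs L (x ∷ _) = x ≡ᵇ L

module _ (k a b : ℕ) .{{_ : NonZero k}} where

  isA isB : ℕ → Bool
  isA x = (x % k) ≡ᵇ (a % k)
  isB x = (x % k) ≡ᵇ (b % k)

  gapOK : ℕ → ℕ → Bool
  gapOK x y = (y + k ≤ᵇ x) ∧ (not (isB x) ∨ (y + k <ᵇ x))
            ∧ (x ≤ᵇ y + 2 * k) ∧ (not (isA y) ∨ (x <ᵇ y + 2 * k))

  chainOK : List ℕ → Bool
  chainOK []           = true
  chainOK (x ∷ [])     = (x ≡ᵇ a) ∨ (x ≡ᵇ b)
  chainOK (x ∷ y ∷ ys) = gapOK x y ∧ chainOK (y ∷ ys)

  isBD : ℕ → List ℕ → Bool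
  isBD m λs = (length λs ≡ᵇ m)
            ∧ allᵇ (λ x → (1 ≤ᵇ x) ∧ (isA x ∨ isB x)) λs
            ∧ chainOK λs

  -- BD_{a,b,k}(m) restricted to largest part L, as an explicit duplicate-free list
  -- (every part is ≤ L, so enumerating lists with entries ≤ L is exhaustive)
  BDlargest : ℕ → ℕ → List (List ℕ)
  BDlargest m L = filterᵇ (λ λs → isBD m λs ∧ headIs L λs) (listsUpTo L m)

  ℓa ℓb : List ℕ → ℕ
  ℓa = countᵇ isA
  ℓb = countᵇ isB

module RingDefs {c ℓ : Level} (R : CommutativeRing c ℓ) where
  open CommutativeRing R using (Carrier; 0#; 1#) renaming (_+_ to _+ᴿ_; _*_ to _*ᴿ_; _-_ to _-ᴿ_)

  pow : Carrier → ℕ → Carrier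
  pow x zero    = 1#
  pow x (suc n) = x *ᴿ pow x n

  poch : Carrier → Carrier → ℕ → Carrier
  poch x p zero    = 1#
  poch x p (suc n) = poch x p n *ᴿ (1# -ᴿ x *ᴿ pow p n)

  pochk : ℕ → Carrier → ℕ → Carrier
  pochk k q n = poch (pow q k) (pow q k) n

  sumR : List Carrier → Carrier
  sumR []       = 0#
  sumR (x ∷ xs) = x +ᴿ sumR xs

  genSum : (k a b : ℕ) .{{_ : NonZero k}} → Carrier → Carrier → Carrier → List (List ℕ) → Carrier
  genSum k a b u v q S =
    sumR (map (λ λs → pow u (ℓa k a b λs) *ᴿ pow v (ℓb k a b λs) *ᴿ pow q (sumℕ λs)) S)

{-# OPTIONS --safe #-}
-- Every admissible part has the form r + c·k with r ∈ {a, b}. Since the residues lie in [1, k],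
-- parts compare lexicographically by (c, r), and the gap conditions say exactly that the part
-- following r + c·k is a + (c − 1)·k or b + (c − 2)·k. Hence the generating function Ψ m c of
-- the m parts below a part of index c satisfies
--   Ψ (m + 1) c = u q^(a + (c − 1)k) Ψ m (c − 1) + v q^(b + (c − 2)k) Ψ m (c − 2),
-- which, multiplied by (q^k;q^k)_h (q^k;q^k)_(m − h) at c = m + h, is the q-Pascal recurrence
-- [m + 1, h + 1] = q^(k(h + 1)) [m, h + 1] + [m, h]; induction on m gives the closed form.
module Submission where

open import Defs
open import Level using (Level)
open import Data.Nat using (ℕ; _+_; _*_; _∸_; _≤_; _<_; NonZero)
open import Data.Nat.Combinatorics using (_C_)
open import Data.Product using (_×_)
open import Algebra.Bundles using (CommutativeRing)

open import Data.Bool using (Bool; true; false; T; not; _∧_; _∨_; if_then_else_)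
open import Data.Bool.Properties using (T-∧; T-∨; T-≡; ∧-comm; ∧-commutativeMonoid; ∧-zeroʳ; ∨-identityʳ)
open import Data.Empty using (⊥-elim)
open import Data.List using (List; []; _∷_; _++_; map; concatMap; upTo; length)
open import Data.List.Properties using (map-∘; upTo-∷ʳ)
open import Data.List.Relation.Unary.All as All using (All; []; _∷_)
open import Data.Nat using (suc; zero; z≤n; s≤s; s≤s⁻¹; _≤ᵇ_; _≡ᵇ_)
open import Data.Nat.Combinatorics using (nCk+nC[k+1]≡[n+1]C[k+1]; nC1≡n)
open import Data.Nat.DivMod using (_%_; _/_; m≡m%n+[m/n]*n; [m+kn]%n≡m%n; m<n⇒m%n≡m; n%n≡0)
open import Data.Nat.Properties as ℕₚ using (_≟_)
open import Data.Nat.Tactic.RingSolver using (solve-∀)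
open import Data.Product using (_,_; ∃₂; proj₂; uncurry)
open import Data.Sum using (inj₁; inj₂)
open import Data.Unit using (tt)
open import Function using (_∘_; _⇔_; mk⇔; Equivalence)
open import Relation.Binary.PropositionalEquality as ≡ using (_≡_; _≢_)
open import Relation.Nullary using (contradiction; yes; no)
open import Relation.Nullary.Decidable using (dec-true; dec-false; T?)

open Equivalence using (to; from)

T-not-∨ : ∀ s t → T (not s ∨ t) ⇔ (T s → T t)
T-not-∨ false t = mk⇔ (λ _ ()) (λ _ → tt)
T-not-∨ true  t = mk⇔ (λ t _ → t) (λ f → f tt)

≡ᵇ-refl : ∀ n → (n ≡ᵇ n) ≡ true
≡ᵇ-refl n = dec-true (n ≟ n) ≡.refl

≢⇒≡ᵇ-false : ∀ {m n} → m ≢ n → (m ≡ᵇ n) ≡ false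
≢⇒≡ᵇ-false {m} {n} = dec-false (m ≟ n)

module Sums {c ℓ : Level} (R : CommutativeRing c ℓ) where
  open CommutativeRing R renaming (_+_ to _+ᴿ_; _*_ to _*ᴿ_)
  open import Algebra.Properties.CommutativeSemigroup +-commutativeSemigroup using () renaming (interchange to +-interchange)
  open RingDefs R using (sumR)
  open import Relation.Binary.Reasoning.Setoid setoid

  ∑ : {X : Set} → List X → (X → Carrier) → Carrier
  ∑ xs f = sumR (map f xs)

  when : Bool → Carrier → Carrier
  when t x = if t then x else 0#

  ∑-cong : {X : Set} (xs : List X) {f g : X → Carrier} → (∀ x → f x ≈ g x) → ∑ xs f ≈ ∑ xs g
  ∑-cong []       f≈g = refl
  ∑-cong (x ∷ xs) f≈g = +-cong (f≈g x) (∑-cong xs f≈g)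

  ∑-cong-All : {X : Set} {xs : List X} {f g : X → Carrier} → All (λ x → f x ≈ g x) xs → ∑ xs f ≈ ∑ xs g
  ∑-cong-All []            = refl
  ∑-cong-All (fx≈gx ∷ f≈g) = +-cong fx≈gx (∑-cong-All f≈g)

  ∑-zero : {X : Set} (xs : List X) {f : X → Carrier} → (∀ x → f x ≈ 0#) → ∑ xs f ≈ 0#
  ∑-zero []       f≈0 = refl
  ∑-zero (x ∷ xs) f≈0 = trans (+-cong (f≈0 x) (∑-zero xs f≈0)) (+-identityʳ 0#)

  ∑-++ : {X : Set} (xs ys : List X) (f : X → Carrier) → ∑ (xs ++ ys) f ≈ ∑ xs f +ᴿ ∑ ys f
  ∑-++ []       ys f = sym (+-identityˡ _)
  ∑-++ (x ∷ xs) ys f = trans (+-congˡ (∑-++ xs ys f)) (sym (+-assoc _ _ _))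

  ∑-map : {X Y : Set} (h : X → Y) (xs : List X) (f : Y → Carrier) → ∑ (map h xs) f ≡ ∑ xs (f ∘ h)
  ∑-map h xs f = ≡.cong sumR (≡.sym (map-∘ xs))

  ∑-concatMap : {X Y : Set} (g : X → List Y) (xs : List X) (f : Y → Carrier) →
                ∑ (concatMap g xs) f ≈ ∑ xs (λ x → ∑ (g x) f)
  ∑-concatMap g []       f = refl
  ∑-concatMap g (x ∷ xs) f = trans (∑-++ (g x) (concatMap g xs) f) (+-congˡ (∑-concatMap g xs f))

  ∑-filterᵇ : {X : Set} (p : X → Bool) (xs : List X) (f : X → Carrier) →
              ∑ (filterᵇ p xs) f ≈ ∑ xs (λ x → when (p x) (f x))
  ∑-filterᵇ p []       f = refl
  ∑-filterᵇ p (x ∷ xs) f with p x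
  ... | true  = +-congˡ (∑-filterᵇ p xs f)
  ... | false = trans (∑-filterᵇ p xs f) (sym (+-identityˡ _))

  ∑-+ : {X : Set} (xs : List X) (f g : X → Carrier) → ∑ xs (λ x → f x +ᴿ g x) ≈ ∑ xs f +ᴿ ∑ xs g
  ∑-+ []       f g = sym (+-identityʳ 0#)
  ∑-+ (x ∷ xs) f g = trans (+-congˡ (∑-+ xs f g)) (+-interchange _ _ _ _)

  ∑-*ˡ : {X : Set} (xs : List X) (s : Carrier) (f : X → Carrier) → ∑ xs (λ x → s *ᴿ f x) ≈ s *ᴿ ∑ xs f
  ∑-*ˡ []       s f = sym (zeroʳ s)
  ∑-*ˡ (x ∷ xs) s f = trans (+-congˡ (∑-*ˡ xs s f)) (sym (distribˡ s _ _))

  ∑-comm : {X Y : Set} (xs : List X) (ys : List Y) (f : X → Y → Carrier) →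
           ∑ xs (λ x → ∑ ys (f x)) ≈ ∑ ys (λ y → ∑ xs (λ x → f x y))
  ∑-comm []       ys f = sym (∑-zero ys (λ _ → refl))
  ∑-comm (x ∷ xs) ys f = trans (+-congˡ (∑-comm xs ys f)) (sym (∑-+ ys (f x) _))

  ∑-when : {X : Set} (xs : List X) (t : Bool) (f : X → Carrier) → ∑ xs (λ x → when t (f x)) ≈ when t (∑ xs f)
  ∑-when xs true  f = refl
  ∑-when xs false f = ∑-zero xs (λ _ → refl)

  when-∧ : ∀ s t x → when (s ∧ t) x ≡ when s (when t x)
  when-∧ false t x = ≡.refl
  when-∧ true  t x = ≡.refl

  when-zero : ∀ t {x} → x ≈ 0# → when t x ≈ 0#
  when-zero false x≈0 = refl
  when-zero true  x≈0 = x≈0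

  when-cong : ∀ t {x y} → x ≈ y → when t x ≈ when t y
  when-cong false x≈y = refl
  when-cong true  x≈y = x≈y

  when-*ˡ : ∀ t s x → when t (s *ᴿ x) ≈ s *ᴿ when t x
  when-*ˡ false s x = sym (zeroʳ s)
  when-*ˡ true  s x = refl

  ∑-listsUpTo-suc : ∀ N m (f : List ℕ → Carrier) →
                    ∑ (listsUpTo N (suc m)) f ≈ ∑ (upTo (suc N)) (λ x → ∑ (listsUpTo N m) (λ ys → f (x ∷ ys)))
  ∑-listsUpTo-suc N m f = trans (∑-concatMap (λ x → map (x ∷_) (listsUpTo N m)) (upTo (suc N)) f)
    (∑-cong (upTo (suc N)) (λ x → reflexive (∑-map (x ∷_) (listsUpTo N m) f)))

  ∑-upTo-suc : ∀ n (f : ℕ → Carrier) → ∑ (upTo (suc n)) f ≈ ∑ (upTo n) f +ᴿ f n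
  ∑-upTo-suc n f = begin
    ∑ (upTo (suc n)) f       ≡⟨ ≡.cong (λ xs → ∑ xs f) (≡.sym (upTo-∷ʳ n)) ⟩
    ∑ (upTo n ++ n ∷ []) f   ≈⟨ ∑-++ (upTo n) (n ∷ []) f ⟩
    ∑ (upTo n) f +ᴿ (f n +ᴿ 0#) ≈⟨ +-congˡ (+-identityʳ (f n)) ⟩
    ∑ (upTo n) f +ᴿ f n      ∎

  ∑-select-beyond : ∀ {n z} (g : ℕ → Carrier) → n ≤ z → ∑ (upTo n) (λ y → when (y ≡ᵇ z) (g y)) ≈ 0#
  ∑-select-beyond {zero}  g _     = refl
  ∑-select-beyond {suc n} {z} g n<z = begin
    ∑ (upTo (suc n)) (λ y → when (y ≡ᵇ z) (g y))
      ≈⟨ ∑-upTo-suc n _ ⟩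
    ∑ (upTo n) (λ y → when (y ≡ᵇ z) (g y)) +ᴿ when (n ≡ᵇ z) (g n)
      ≈⟨ +-cong (∑-select-beyond g (ℕₚ.<⇒≤ n<z))
                (reflexive (≡.cong (λ t → when t (g n)) (≢⇒≡ᵇ-false (ℕₚ.<⇒≢ n<z)))) ⟩
    0# +ᴿ 0#
      ≈⟨ +-identityʳ 0# ⟩
    0# ∎

  ∑-select : ∀ {n z} (g : ℕ → Carrier) → z < n → ∑ (upTo n) (λ y → when (y ≡ᵇ z) (g y)) ≈ g z
  ∑-select {suc n} {z} g z<1+n with ℕₚ.m≤n⇒m<n∨m≡n (s≤s⁻¹ z<1+n)
  ... | inj₁ z<n = begin
    ∑ (upTo (suc n)) (λ y → when (y ≡ᵇ z) (g y))
      ≈⟨ ∑-upTo-suc n _ ⟩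
    ∑ (upTo n) (λ y → when (y ≡ᵇ z) (g y)) +ᴿ when (n ≡ᵇ z) (g n)
      ≈⟨ +-cong (∑-select g z<n) (reflexive (≡.cong (λ t → when t (g n)) (≢⇒≡ᵇ-false (ℕₚ.>⇒≢ z<n)))) ⟩
    g z +ᴿ 0#
      ≈⟨ +-identityʳ (g z) ⟩
    g z ∎
  ... | inj₂ ≡.refl = begin
    ∑ (upTo (suc n)) (λ y → when (y ≡ᵇ n) (g y))
      ≈⟨ ∑-upTo-suc n _ ⟩
    ∑ (upTo n) (λ y → when (y ≡ᵇ n) (g y)) +ᴿ when (n ≡ᵇ n) (g n)
      ≈⟨ +-cong (∑-select-beyond {n} g ℕₚ.≤-refl) (reflexive (≡.cong (λ t → when t (g n)) (≡ᵇ-refl n))) ⟩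
    0# +ᴿ g n
      ≈⟨ +-identityˡ (g n) ⟩
    g n ∎

module Powers {c ℓ : Level} (R : CommutativeRing c ℓ) where
  open CommutativeRing R renaming (_+_ to _+ᴿ_; _*_ to _*ᴿ_)
  open RingDefs R using (pow)

  pow-+ : ∀ x m n → pow x (m + n) ≈ pow x m *ᴿ pow x n
  pow-+ x zero    n = sym (*-identityˡ _)
  pow-+ x (suc m) n = trans (*-congˡ (pow-+ x m n)) (sym (*-assoc _ _ _))

  pow-* : ∀ x m n → pow (pow x m) n ≈ pow x (m * n)
  pow-* x m zero    = reflexive (≡.cong (pow x) (≡.sym (ℕₚ.*-zeroʳ m)))
  pow-* x m (suc n) = begin
    pow x m *ᴿ pow (pow x m) n ≈⟨ *-congˡ (pow-* x m n) ⟩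
    pow x m *ᴿ pow x (m * n)   ≈⟨ sym (pow-+ x m (m * n)) ⟩
    pow x (m + m * n)          ≡⟨ ≡.cong (pow x) (≡.sym (ℕₚ.*-suc m n)) ⟩
    pow x (m * suc n)          ∎
    where open import Relation.Binary.Reasoning.Setoid setoid

  pow-if-suc : ∀ x (t : Bool) n → pow x (if t then suc n else n) ≈ pow x (if t then 1 else 0) *ᴿ pow x n
  pow-if-suc x true  n = *-congʳ (sym (*-identityʳ x))
  pow-if-suc x false n = sym (*-identityˡ _)

module Rearrangements {c ℓ : Level} (R : CommutativeRing c ℓ) where
  open CommutativeRing R renaming (_+_ to _+ᴿ_; _*_ to _*ᴿ_)
  open import Algebra.Solver.Ring.NaturalCoefficients.Default commutativeSemiring using (solve; _:+_; _:*_; _:=_)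

  xy∙zwt≈xz∙w∙yt : ∀ x y z w t → (x *ᴿ y) *ᴿ (z *ᴿ w *ᴿ t) ≈ (x *ᴿ z) *ᴿ w *ᴿ (y *ᴿ t)
  xy∙zwt≈xz∙w∙yt = solve 5 (λ x y z w t → (x :* y) :* (z :* w :* t) := (x :* z) :* w :* (y :* t)) refl

  xy∙zwt≈z∙xw∙yt : ∀ x y z w t → (x *ᴿ y) *ᴿ (z *ᴿ w *ᴿ t) ≈ z *ᴿ (x *ᴿ w) *ᴿ (y *ᴿ t)
  xy∙zwt≈z∙xw∙yt = solve 5 (λ x y z w t → (x :* y) :* (z :* w :* t) := z :* (x :* w) :* (y :* t)) refl

  y∙zwt≈zw∙yt : ∀ y z w t → y *ᴿ (z *ᴿ w *ᴿ t) ≈ z *ᴿ w *ᴿ (y *ᴿ t)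
  y∙zwt≈zw∙yt = solve 4 (λ y z w t → y :* (z :* w :* t) := z :* w :* (y :* t)) refl

  xy∙zt≈z∙xyt : ∀ x y z t → x *ᴿ y *ᴿ (z *ᴿ t) ≈ z *ᴿ (x *ᴿ y *ᴿ t)
  xy∙zt≈z∙xyt = solve 4 (λ x y z t → x :* y :* (z :* t) := z :* (x :* y :* t)) refl

  x[yz]∙wt≈wz∙xyt : ∀ x y z w t → x *ᴿ (y *ᴿ z) *ᴿ (w *ᴿ t) ≈ (w *ᴿ z) *ᴿ (x *ᴿ y *ᴿ t)
  x[yz]∙wt≈wz∙xyt = solve 5 (λ x y z w t → x :* (y :* z) :* (w :* t) := (w :* z) :* (x :* y :* t)) refl

  yz∙x∙wt≈wz∙yxt : ∀ x y z w t → (y *ᴿ z) *ᴿ x *ᴿ (w *ᴿ t) ≈ (w *ᴿ z) *ᴿ (y *ᴿ x *ᴿ t)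
  yz∙x∙wt≈wz∙yxt = solve 5 (λ x y z w t → (y :* z) :* x :* (w :* t) := (w :* z) :* (y :* x :* t)) refl

  wz∙sy≈ws∙yz : ∀ w z s y → (w *ᴿ z) *ᴿ (s *ᴿ y) ≈ (w *ᴿ s) *ᴿ (y *ᴿ z)
  wz∙sy≈ws∙yz = solve 4 (λ w z s y → (w :* z) :* (s :* y) := (w :* s) :* (y :* z)) refl

  distribute-factors : ∀ p o p′ o′ w s w′ s′ →
    (p *ᴿ o) *ᴿ (p′ *ᴿ o′) *ᴿ (w *ᴿ s +ᴿ w′ *ᴿ s′)
      ≈ (w *ᴿ o′) *ᴿ ((p *ᴿ o) *ᴿ p′ *ᴿ s) +ᴿ (w′ *ᴿ o) *ᴿ (p *ᴿ (p′ *ᴿ o′) *ᴿ s′)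
  distribute-factors = solve 8 (λ p o p′ o′ w s w′ s′ →
    (p :* o) :* (p′ :* o′) :* (w :* s :+ w′ :* s′)
      := (w :* o′) :* ((p :* o) :* p′ :* s) :+ (w′ :* o) :* (p :* (p′ :* o′) :* s′)) refl

  xy∙zw+y∙zt≈yz∙[xw+t] : ∀ x y z w t → (x *ᴿ y) *ᴿ (z *ᴿ w) +ᴿ y *ᴿ (z *ᴿ t) ≈ y *ᴿ z *ᴿ (x *ᴿ w +ᴿ t)
  xy∙zw+y∙zt≈yz∙[xw+t] = solve 5 (λ x y z w t → (x :* y) :* (z :* w) :+ y :* (z :* t) := y :* z :* (x :* w :+ t)) refl

  x[1-y]+[1-x]≈1-xy : ∀ x y → x *ᴿ (1# - y) +ᴿ (1# - x) ≈ 1# - x *ᴿ y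
  x[1-y]+[1-x]≈1-xy x y = begin
    x *ᴿ (1# - y) +ᴿ (1# - x)        ≈⟨ +-congʳ (trans (distribˡ x 1# (- y)) (+-cong (*-identityʳ x) (sym (-‿distribʳ-* x y)))) ⟩
    (x - x *ᴿ y) +ᴿ (1# - x)         ≈⟨ swap-outer x (- (x *ᴿ y)) 1# (- x) ⟩
    (1# - x *ᴿ y) +ᴿ (x - x)         ≈⟨ +-congˡ (-‿inverseʳ x) ⟩
    (1# - x *ᴿ y) +ᴿ 0#              ≈⟨ +-identityʳ _ ⟩
    1# - x *ᴿ y                      ∎
    where
    open import Relation.Binary.Reasoning.Setoid setoid
    open import Algebra.Properties.Ring ring using (-‿distribʳ-*)
    swap-outer : ∀ w x y z → (w +ᴿ x) +ᴿ (y +ᴿ z) ≈ (y +ᴿ x) +ᴿ (w +ᴿ z)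
    swap-outer = solve 4 (λ w x y z → (w :+ x) :+ (y :+ z) := (y :+ x) :+ (w :+ z)) refl

module Parts (a b k : ℕ) .{{_ : NonZero k}} (1≤a : 1 ≤ a) (a<b : a < b) (b≤k : b ≤ k) where
  open ≡ using (refl; sym; trans; cong; cong₂; subst; module ≡-Reasoning)
  open ℕₚ

  data Residue : Set where
    A B : Residue

  residue : Residue → ℕ
  residue A = a
  residue B = b

  part : Residue → ℕ → ℕ
  part r c = residue r + c * k

  shift : Residue → ℕ
  shift A = 1
  shift B = 2

  valid : ℕ → Bool
  valid x = (1 ≤ᵇ x) ∧ (isA k a b x ∨ isB k a b x)

  a≤residue : ∀ r → a ≤ residue r
  a≤residue A = ≤-refl
  a≤residue B = <⇒≤ a<b

  residue≤b : ∀ r → residue r ≤ b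
  residue≤b A = <⇒≤ a<b
  residue≤b B = ≤-refl

  part-suc : ∀ r c → part r c + k ≡ part r (suc c)
  part-suc r c = polynomial-identity (residue r) c k
    where
    polynomial-identity : ∀ x c k → x + c * k + k ≡ x + (1 + c) * k
    polynomial-identity = solve-∀

  part-2+ : ∀ r c → part r c + 2 * k ≡ part r (2 + c)
  part-2+ r c = polynomial-identity (residue r) c k
    where
    polynomial-identity : ∀ x c k → x + c * k + 2 * k ≡ x + (2 + c) * k
    polynomial-identity = solve-∀

  part-mono-≤ : ∀ r r′ {c e} → c ≤ e → residue r ≤ residue r′ → part r c ≤ part r′ e
  part-mono-≤ _ _ c≤e r≤r′ = +-mono-≤ r≤r′ (*-monoˡ-≤ k c≤e)

  part-mono-< : ∀ r r′ {c e} → c ≤ e → residue r < residue r′ → part r c < part r′ e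
  part-mono-< _ _ c≤e r<r′ = +-mono-<-≤ r<r′ (*-monoˡ-≤ k c≤e)

  part-<-index : ∀ r r′ {c e} → c < e → part r c < part r′ e
  part-<-index r r′ {c} {e} c<e = begin-strict
    residue r + c * k  ≤⟨ +-monoˡ-≤ (c * k) (≤-trans (residue≤b r) b≤k) ⟩
    suc c * k          ≤⟨ *-monoˡ-≤ k c<e ⟩
    e * k              <⟨ m<n+m (e * k) (≤-trans 1≤a (a≤residue r′)) ⟩
    residue r′ + e * k ∎
    where open ≤-Reasoning

  part-≤⇒index-≤ : ∀ r r′ {c e} → part r c ≤ part r′ e → c ≤ e
  part-≤⇒index-≤ r r′ p≤p′ = ≮⇒≥ (λ e<c → <⇒≱ (part-<-index r′ r e<c) p≤p′)

  part-<⇒index-< : ∀ r r′ {c e} → residue r′ ≤ residue r → part r c < part r′ e → c < e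
  part-<⇒index-< r r′ r′≤r p<p′ = ≰⇒> (λ e≤c → <⇒≱ p<p′ (part-mono-≤ r′ r e≤c r′≤r))

  part-≤⇒index-< : ∀ r r′ {c e} → residue r < residue r′ → part r′ e ≤ part r c → e < c
  part-≤⇒index-< r r′ r<r′ p′≤p = ≰⇒> (λ c≤e → <⇒≱ (part-mono-< r r′ c≤e r<r′) p′≤p)

  a%k≡a : a % k ≡ a
  a%k≡a = m<n⇒m%n≡m (<-≤-trans a<b b≤k)

  b%k≢a : b % k ≢ a
  b%k≢a with m≤n⇒m<n∨m≡n b≤k
  ... | inj₁ b<k  = λ e → <⇒≢ a<b (trans (sym e) (m<n⇒m%n≡m b<k))
  ... | inj₂ refl = λ e → <⇒≢ 1≤a (trans (sym (n%n≡0 b)) e)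

  part%k : ∀ r c → part r c % k ≡ residue r % k
  part%k r c = [m+kn]%n≡m%n (residue r) c k

  isA-part-A : ∀ c → isA k a b (part A c) ≡ true
  isA-part-A c = trans (cong (_≡ᵇ a % k) (part%k A c)) (≡ᵇ-refl (a % k))

  isA-part-B : ∀ c → isA k a b (part B c) ≡ false
  isA-part-B c = trans (cong (_≡ᵇ a % k) (part%k B c)) (≢⇒≡ᵇ-false (λ e → b%k≢a (trans e a%k≡a)))

  isB-part-A : ∀ c → isB k a b (part A c) ≡ false
  isB-part-A c = trans (cong (_≡ᵇ b % k) (part%k A c)) (≢⇒≡ᵇ-false (λ e → b%k≢a (trans (sym e) a%k≡a)))

  isB-part-B : ∀ c → isB k a b (part B c) ≡ true
  isB-part-B c = trans (cong (_≡ᵇ b % k) (part%k B c)) (≡ᵇ-refl (b % k))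

  1≤part : ∀ r c → 1 ≤ part r c
  1≤part r c = ≤-trans (≤-trans 1≤a (a≤residue r)) (m≤m+n (residue r) (c * k))

  valid-part : ∀ r c → valid (part r c) ≡ true
  valid-part r c = cong₂ _∧_ (to T-≡ (≤⇒≤ᵇ (1≤part r c))) (residue-class r)
    where
    residue-class : ∀ r → isA k a b (part r c) ∨ isB k a b (part r c) ≡ true
    residue-class A = cong (_∨ isB k a b (part A c)) (isA-part-A c)
    residue-class B = cong₂ _∨_ (isA-part-B c) (isB-part-B c)

  m%k≡s⇒m≡s+[m/k]*k : ∀ m {s} → m % k ≡ s → m ≡ s + (m / k) * k
  m%k≡s⇒m≡s+[m/k]*k m e = trans (m≡m%n+[m/n]*n m k) (cong (_+ (m / k) * k) e)

  -- When b = k the class of b is that of 0, so y / k must be lowered by one.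
  valid⇒part : ∀ y → T (valid y) → ∃₂ λ r d → y ≡ part r d
  valid⇒part y v with to T-∧ v
  ... | 1≤y , class with to T-∨ class
  ... | inj₁ y≡a = A , y / k , m%k≡s⇒m≡s+[m/k]*k y (trans (≡ᵇ⇒≡ _ _ y≡a) a%k≡a)
  ... | inj₂ y≡b with m≤n⇒m<n∨m≡n b≤k
  ...   | inj₁ b<k = B , y / k , m%k≡s⇒m≡s+[m/k]*k y (trans (≡ᵇ⇒≡ _ _ y≡b) (m<n⇒m%n≡m b<k))
  ...   | inj₂ b≡k = multiple (y / k) (m%k≡s⇒m≡s+[m/k]*k y (trans (≡ᵇ⇒≡ _ _ y≡b) (trans (cong (_% k) b≡k) (n%n≡0 k))))
    where
    multiple : ∀ q → y ≡ 0 + q * k → ∃₂ λ r d → y ≡ part r d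
    multiple zero    y≡0 = contradiction (subst (1 ≤_) y≡0 (≤ᵇ⇒≤ 1 y 1≤y)) λ ()
    multiple (suc d) y≡k+dk = B , d , trans y≡k+dk (cong (_+ d * k) (sym b≡k))

  part-injective : ∀ r {d d′} → part r d ≡ part r d′ → d ≡ d′
  part-injective r {d} {d′} e = *-cancelʳ-≡ d d′ k (+-cancelˡ-≡ (residue r) _ _ e)

  part-A≢part-B : ∀ d d′ → part A d ≢ part B d′
  part-A≢part-B d d′ e with trans (sym (isA-part-A d)) (trans (cong (isA k a b) e) (isA-part-B d′))
  ... | ()

  part-≡ᵇ : ∀ r d d′ → (part r d ≡ᵇ part r d′) ≡ (d ≡ᵇ d′)
  part-≡ᵇ r d d′ with d ≟ d′
  ... | yes refl = trans (≡ᵇ-refl (part r d)) (sym (≡ᵇ-refl d))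
  ... | no d≢d′  = trans (≢⇒≡ᵇ-false (d≢d′ ∘ part-injective r)) (sym (≢⇒≡ᵇ-false d≢d′))

  part-A≡ᵇpart-B : ∀ d d′ → (part A d ≡ᵇ part B d′) ≡ false
  part-A≡ᵇpart-B d d′ = ≢⇒≡ᵇ-false (part-A≢part-B d d′)

  part-B≡ᵇpart-A : ∀ d d′ → (part B d ≡ᵇ part A d′) ≡ false
  part-B≡ᵇpart-A d d′ = ≢⇒≡ᵇ-false (part-A≢part-B d′ d ∘ sym)

  record Gap (x y : ℕ) : Set where
    field
      k≤gap       : y + k ≤ x
      k<gap-at-b  : T (isB k a b x) → y + k < x
      gap≤2k      : x ≤ y + 2 * k
      gap<2k-at-a : T (isA k a b y) → x < y + 2 * k

  gapOK⇔Gap : ∀ x y → T (gapOK k a b x y) ⇔ Gap x y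
  gapOK⇔Gap x y = mk⇔ toGap fromGap
    where
    toGap : T (gapOK k a b x y) → Gap x y
    toGap g with to T-∧ g
    ... | p₁ , g₂ with to T-∧ g₂
    ... | p₂ , g₃ with to T-∧ g₃
    ... | p₃ , p₄ = record
      { k≤gap       = ≤ᵇ⇒≤ _ _ p₁
      ; k<gap-at-b  = <ᵇ⇒< _ _ ∘ to (T-not-∨ _ _) p₂
      ; gap≤2k      = ≤ᵇ⇒≤ _ _ p₃
      ; gap<2k-at-a = <ᵇ⇒< _ _ ∘ to (T-not-∨ _ _) p₄
      }
    fromGap : Gap x y → T (gapOK k a b x y)
    fromGap G = from T-∧ (≤⇒≤ᵇ k≤gap , from T-∧ (from (T-not-∨ _ _) (<⇒<ᵇ ∘ k<gap-at-b) ,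
                  from T-∧ (≤⇒≤ᵇ gap≤2k , from (T-not-∨ _ _) (<⇒<ᵇ ∘ gap<2k-at-a))))
      where open Gap G

  Gap⇒index : ∀ r c r′ d → Gap (part r c) (part r′ d) → shift r′ + d ≡ c
  Gap⇒index r c A d G = ≤-antisym
    (part-≤⇒index-≤ A r (subst (_≤ part r c) (part-suc A d) k≤gap))
    (s≤s⁻¹ (part-<⇒index-< r A (a≤residue r) (subst (part r c <_) (part-2+ A d) (gap<2k-at-a (from T-≡ (isA-part-A d))))))
    where open Gap G
  Gap⇒index r c B d G = ≤-antisym (lower r G)
    (part-≤⇒index-≤ r B (subst (part r c ≤_) (part-2+ B d) gap≤2k))
    where
    open Gap G
    lower : ∀ r → Gap (part r c) (part B d) → suc d < c
    lower A G = part-≤⇒index-< A B a<b (subst (_≤ part A c) (part-suc B d) (Gap.k≤gap G))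
    lower B G = part-<⇒index-< B B ≤-refl (subst (_< part B c) (part-suc B d) (Gap.k<gap-at-b G (from T-≡ (isB-part-B c))))

  index⇒Gap : ∀ r r′ d → Gap (part r (shift r′ + d)) (part r′ d)
  index⇒Gap r A d = record
    { k≤gap       = subst (_≤ part r (suc d)) (sym (part-suc A d)) (part-mono-≤ A r (≤-refl {suc d}) (a≤residue r))
    ; k<gap-at-b  = k<gap r
    ; gap≤2k      = <⇒≤ gap<2k
    ; gap<2k-at-a = λ _ → gap<2k
    }
    where
    gap<2k : part r (suc d) < part A d + 2 * k
    gap<2k = subst (part r (suc d) <_) (sym (part-2+ A d)) (part-<-index r A (n<1+n (suc d)))
    k<gap : ∀ r → T (isB k a b (part r (suc d))) → part A d + k < part r (suc d)
    k<gap A isB = ⊥-elim (subst T (isB-part-A (suc d)) isB)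
    k<gap B _   = subst (_< part B (suc d)) (sym (part-suc A d)) (part-mono-< A B (≤-refl {suc d}) a<b)
  index⇒Gap r B d = record
    { k≤gap       = <⇒≤ k<gap
    ; k<gap-at-b  = λ _ → k<gap
    ; gap≤2k      = subst (part r (2 + d) ≤_) (sym (part-2+ B d)) (part-mono-≤ r B (≤-refl {2 + d}) (residue≤b r))
    ; gap<2k-at-a = λ isA → ⊥-elim (subst T (isA-part-B d) isA)
    }
    where
    k<gap : part B d + k < part r (2 + d)
    k<gap = subst (_< part r (2 + d)) (sym (part-suc B d)) (part-<-index B r (n<1+n (suc d)))

  gapOK-part : ∀ r c r′ d → gapOK k a b (part r c) (part r′ d) ≡ (shift r′ + d ≡ᵇ c)
  gapOK-part r c r′ d with shift r′ + d ≟ c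
  ... | yes refl = trans (dec-true (T? _) (from (gapOK⇔Gap _ _) (index⇒Gap r r′ d))) (sym (≡ᵇ-refl c))
  ... | no ≢c    = trans (dec-false (T? _) (≢c ∘ Gap⇒index r c r′ d ∘ to (gapOK⇔Gap _ _))) (sym (≢⇒≡ᵇ-false ≢c))

  isBD-∷-∷ : ∀ m x y ys → isBD k a b (2 + m) (x ∷ y ∷ ys) ≡ (valid x ∧ gapOK k a b x y) ∧ isBD k a b (suc m) (y ∷ ys)
  isBD-∷-∷ m x y ys = solve 6 (λ l vx vy vs g ch → l ⊕ (vx ⊕ vy ⊕ vs) ⊕ g ⊕ ch ⊜ (vx ⊕ g) ⊕ l ⊕ (vy ⊕ vs) ⊕ ch) refl
    (length ys ≡ᵇ m) (valid x) (valid y) (allᵇ valid ys) (gapOK k a b x y) (chainOK k a b (y ∷ ys))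
    where open import Algebra.Solver.CommutativeMonoid ∧-commutativeMonoid using (solve; _⊕_; _⊜_)

  isBD-invalid-head : ∀ m x ys → valid x ≡ false → isBD k a b (suc m) (x ∷ ys) ≡ false
  isBD-invalid-head m x ys invalid =
    trans (cong (λ v → (length ys ≡ᵇ m) ∧ (v ∧ allᵇ valid ys) ∧ chainOK k a b (x ∷ ys)) invalid) (∧-zeroʳ _)

  residue≡part-0 : ∀ r → residue r ≡ part r 0
  residue≡part-0 r = sym (+-identityʳ (residue r))

  isBD-singleton : ∀ r c → isBD k a b 1 (part r c ∷ []) ≡ (c ≡ᵇ 0)
  isBD-singleton r c = begin
      (valid (part r c) ∧ true) ∧ ((part r c ≡ᵇ a) ∨ (part r c ≡ᵇ b))
    ≡⟨ cong (λ v → (v ∧ true) ∧ ((part r c ≡ᵇ a) ∨ (part r c ≡ᵇ b))) (valid-part r c) ⟩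
      (part r c ≡ᵇ a) ∨ (part r c ≡ᵇ b)
    ≡⟨ cong₂ (λ s t → (part r c ≡ᵇ s) ∨ (part r c ≡ᵇ t)) (residue≡part-0 A) (residue≡part-0 B) ⟩
      (part r c ≡ᵇ part A 0) ∨ (part r c ≡ᵇ part B 0)
    ≡⟨ lowest r ⟩
      c ≡ᵇ 0 ∎
    where
    open ≡-Reasoning
    lowest : ∀ r → (part r c ≡ᵇ part A 0) ∨ (part r c ≡ᵇ part B 0) ≡ (c ≡ᵇ 0)
    lowest A = trans (cong₂ _∨_ (part-≡ᵇ A c 0) (part-A≡ᵇpart-B c 0)) (∨-identityʳ _)
    lowest B = cong₂ _∨_ (part-B≡ᵇpart-A c 0) (part-≡ᵇ B c 0)

module Enumeration {c ℓ : Level} (R : CommutativeRing c ℓ)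
  (a b k : ℕ) .{{_ : NonZero k}} (1≤a : 1 ≤ a) (a<b : a < b) (b≤k : b ≤ k)
  (u v q : CommutativeRing.Carrier R) where
  open CommutativeRing R renaming (_+_ to _+ᴿ_; _*_ to _*ᴿ_)
  open RingDefs R using (pow; genSum)
  open Sums R
  open Powers R
  open Parts a b k 1≤a a<b b≤k
  open import Relation.Binary.Reasoning.Setoid setoid
  open import Algebra.Properties.CommutativeSemigroup *-commutativeSemigroup using () renaming (interchange to *-interchange)

  wt : List ℕ → Carrier
  wt xs = pow u (ℓa k a b xs) *ᴿ pow v (ℓb k a b xs) *ᴿ pow q (sumℕ xs)

  letter : Residue → Carrier
  letter A = u
  letter B = v

  weight : Residue → ℕ → Carrier
  weight r c = letter r *ᴿ pow q (part r c)

  wt-∷ : ∀ x xs → wt (x ∷ xs) ≈ wt (x ∷ []) *ᴿ wt xs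
  wt-∷ x xs = begin
    pow u (ℓa k a b (x ∷ xs)) *ᴿ pow v (ℓb k a b (x ∷ xs)) *ᴿ pow q (x + sumℕ xs)
      ≈⟨ *-cong (*-cong (pow-if-suc u (isA k a b x) _) (pow-if-suc v (isB k a b x) _)) (pow-+ q x (sumℕ xs)) ⟩
    (pow u (ℓa k a b (x ∷ [])) *ᴿ pow u (ℓa k a b xs)) *ᴿ (pow v (ℓb k a b (x ∷ [])) *ᴿ pow v (ℓb k a b xs))
      *ᴿ (pow q x *ᴿ pow q (sumℕ xs))
      ≈⟨ trans (*-congʳ (*-interchange _ _ _ _)) (*-interchange _ _ _ _) ⟩
    (pow u (ℓa k a b (x ∷ [])) *ᴿ pow v (ℓb k a b (x ∷ [])) *ᴿ pow q x) *ᴿ wt xs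
      ≡⟨ ≡.cong (λ n → (pow u (ℓa k a b (x ∷ [])) *ᴿ pow v (ℓb k a b (x ∷ [])) *ᴿ pow q n) *ᴿ wt xs)
                (≡.sym (ℕₚ.+-identityʳ x)) ⟩
    wt (x ∷ []) *ᴿ wt xs ∎

  wt-part : ∀ r c → wt (part r c ∷ []) ≈ weight r c
  wt-part A c = begin
    pow u (ℓa k a b (part A c ∷ [])) *ᴿ pow v (ℓb k a b (part A c ∷ [])) *ᴿ pow q (part A c + 0)
      ≡⟨ ≡.cong₂ (λ s t → pow u (if s then 1 else 0) *ᴿ pow v (if t then 1 else 0) *ᴿ pow q (part A c + 0))
                 (isA-part-A c) (isB-part-A c) ⟩
    (u *ᴿ 1#) *ᴿ 1# *ᴿ pow q (part A c + 0)
      ≈⟨ *-cong (trans (*-identityʳ _) (*-identityʳ u)) (reflexive (≡.cong (pow q) (ℕₚ.+-identityʳ (part A c)))) ⟩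
    weight A c ∎
  wt-part B c = begin
    pow u (ℓa k a b (part B c ∷ [])) *ᴿ pow v (ℓb k a b (part B c ∷ [])) *ᴿ pow q (part B c + 0)
      ≡⟨ ≡.cong₂ (λ s t → pow u (if s then 1 else 0) *ᴿ pow v (if t then 1 else 0) *ᴿ pow q (part B c + 0))
                 (isA-part-B c) (isB-part-B c) ⟩
    1# *ᴿ (v *ᴿ 1#) *ᴿ pow q (part B c + 0)
      ≈⟨ *-cong (trans (*-identityˡ _) (*-identityʳ v)) (reflexive (≡.cong (pow q) (ℕₚ.+-identityʳ (part B c)))) ⟩
    weight B c ∎

  successors : ℕ → List (Residue × ℕ)
  successors zero          = []
  successors (suc zero)    = (A , 0) ∷ []
  successors (suc (suc c)) = (A , suc c) ∷ (B , c) ∷ []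

  successors-below : ∀ c → All (λ p → proj₂ p < c) (successors c)
  successors-below zero          = []
  successors-below (suc zero)    = ℕₚ.n<1+n 0 ∷ []
  successors-below (suc (suc c)) = ℕₚ.n<1+n (suc c) ∷ ℕₚ.m<n+m c (s≤s z≤n) ∷ []

  successors-fiber : ∀ c r d X →
    when (shift r + d ≡ᵇ c) X ≈ ∑ (successors c) (uncurry λ r′ d′ → when (part r d ≡ᵇ part r′ d′) X)
  successors-fiber zero          A d X = refl
  successors-fiber zero          B d X = refl
  successors-fiber (suc zero)    A d X rewrite part-≡ᵇ A d 0 = sym (+-identityʳ _)
  successors-fiber (suc zero)    B d X rewrite part-B≡ᵇpart-A d 0 = sym (+-identityʳ 0#)
  successors-fiber (suc (suc c)) A d X rewrite part-≡ᵇ A d (suc c) | part-A≡ᵇpart-B d c =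
    sym (trans (+-congˡ (+-identityʳ 0#)) (+-identityʳ _))
  successors-fiber (suc (suc c)) B d X rewrite part-B≡ᵇpart-A d (suc c) | part-≡ᵇ B d c =
    sym (trans (+-congˡ (+-identityʳ _)) (+-identityˡ _))

  Ψ : ℕ → ℕ → Carrier
  Ψ zero    zero    = 1#
  Ψ zero    (suc c) = 0#
  Ψ (suc m) c       = ∑ (successors c) (uncurry λ r d → weight r d *ᴿ Ψ m d)

  gapOK-as-∑ : ∀ r c (g : ℕ → Carrier) → (∀ y → valid y ≡ false → g y ≈ 0#) → ∀ y →
    when (gapOK k a b (part r c) y) (g y) ≈ ∑ (successors c) (uncurry λ r′ d → when (y ≡ᵇ part r′ d) (g y))
  gapOK-as-∑ r c g vanish y with valid y in valid-y
  ... | false = trans (when-zero _ (vanish y valid-y)) (sym (∑-zero (successors c) (λ _ → when-zero _ (vanish y valid-y))))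
  ... | true with valid⇒part y (from T-≡ valid-y)
  ...   | r′ , d , ≡.refl = trans (reflexive (≡.cong (λ t → when t (g (part r′ d))) (gapOK-part r c r′ d)))
                                  (successors-fiber c r′ d (g (part r′ d)))

  ∑-gapOK : ∀ {n} r c (g : ℕ → Carrier) → part r c < n → (∀ y → valid y ≡ false → g y ≈ 0#) →
    ∑ (upTo n) (λ y → when (gapOK k a b (part r c) y) (g y)) ≈ ∑ (successors c) (uncurry λ r′ d → g (part r′ d))
  ∑-gapOK {n} r c g x<n vanish = begin
    ∑ (upTo n) (λ y → when (gapOK k a b (part r c) y) (g y))
      ≈⟨ ∑-cong (upTo n) (gapOK-as-∑ r c g vanish) ⟩
    ∑ (upTo n) (λ y → ∑ (successors c) (uncurry λ r′ d → when (y ≡ᵇ part r′ d) (g y)))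
      ≈⟨ ∑-comm (upTo n) (successors c) _ ⟩
    ∑ (successors c) (uncurry λ r′ d → ∑ (upTo n) (λ y → when (y ≡ᵇ part r′ d) (g y)))
      ≈⟨ ∑-cong-All (All.map (λ {(r′ , d)} d<c → ∑-select g (ℕₚ.<-trans (part-<-index r′ r d<c) x<n)) (successors-below c)) ⟩
    ∑ (successors c) (uncurry λ r′ d → g (part r′ d)) ∎

  tails : ℕ → ℕ → ℕ → Carrier
  tails N m x = ∑ (listsUpTo N m) (λ ys → when (isBD k a b (suc m) (x ∷ ys)) (wt (x ∷ ys)))

  genSum-BDlargest : ∀ m L → genSum k a b u v q (BDlargest k a b (suc m) L) ≈ tails L m L
  genSum-BDlargest m L = begin
    ∑ (BDlargest k a b (suc m) L) wt
      ≈⟨ ∑-filterᵇ _ (listsUpTo L (suc m)) wt ⟩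
    ∑ (listsUpTo L (suc m)) (λ xs → when (isBD k a b (suc m) xs ∧ headIs L xs) (wt xs))
      ≈⟨ ∑-listsUpTo-suc L m _ ⟩
    ∑ (upTo (suc L)) (λ x → ∑ (listsUpTo L m) (λ ys → when (isBD k a b (suc m) (x ∷ ys) ∧ (x ≡ᵇ L)) (wt (x ∷ ys))))
      ≈⟨ ∑-cong (upTo (suc L)) (λ x → ∑-cong (listsUpTo L m) (λ ys →
           reflexive (when-∧-comm (isBD k a b (suc m) (x ∷ ys)) (x ≡ᵇ L) (wt (x ∷ ys))))) ⟩
    ∑ (upTo (suc L)) (λ x → ∑ (listsUpTo L m) (λ ys → when (x ≡ᵇ L) (when (isBD k a b (suc m) (x ∷ ys)) (wt (x ∷ ys)))))
      ≈⟨ ∑-cong (upTo (suc L)) (λ x → ∑-when (listsUpTo L m) (x ≡ᵇ L) _) ⟩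
    ∑ (upTo (suc L)) (λ x → when (x ≡ᵇ L) (tails L m x))
      ≈⟨ ∑-select (tails L m) (ℕₚ.n<1+n L) ⟩
    tails L m L ∎
    where
    when-∧-comm : ∀ s t x → when (s ∧ t) x ≡ when t (when s x)
    when-∧-comm s t x = ≡.trans (≡.cong (λ b → when b x) (∧-comm s t)) (when-∧ t s x)

  tails-invalid : ∀ N m x → valid x ≡ false → tails N m x ≈ 0#
  tails-invalid N m x invalid =
    ∑-zero (listsUpTo N m) (λ ys → reflexive (≡.cong (λ t → when t (wt (x ∷ ys))) (isBD-invalid-head m x ys invalid)))

  tails-suc : ∀ N m x → tails N (suc m) x ≈ ∑ (upTo (suc N)) (λ y → when (valid x ∧ gapOK k a b x y) (wt (x ∷ []) *ᴿ tails N m y))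
  tails-suc N m x = begin
    tails N (suc m) x
      ≈⟨ ∑-listsUpTo-suc N m _ ⟩
    ∑ (upTo (suc N)) (λ y → ∑ (listsUpTo N m) (λ ys → when (isBD k a b (2 + m) (x ∷ y ∷ ys)) (wt (x ∷ y ∷ ys))))
      ≈⟨ ∑-cong (upTo (suc N)) (λ y → ∑-cong (listsUpTo N m) (λ ys → split y ys)) ⟩
    ∑ (upTo (suc N)) (λ y → ∑ (listsUpTo N m) (λ ys →
      when (valid x ∧ gapOK k a b x y) (wt (x ∷ []) *ᴿ when (isBD k a b (suc m) (y ∷ ys)) (wt (y ∷ ys)))))
      ≈⟨ ∑-cong (upTo (suc N)) (λ y → trans (∑-when (listsUpTo N m) _ _) (when-cong _ (∑-*ˡ (listsUpTo N m) _ _))) ⟩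
    ∑ (upTo (suc N)) (λ y → when (valid x ∧ gapOK k a b x y) (wt (x ∷ []) *ᴿ tails N m y)) ∎
    where
    split : ∀ y ys → when (isBD k a b (2 + m) (x ∷ y ∷ ys)) (wt (x ∷ y ∷ ys))
                   ≈ when (valid x ∧ gapOK k a b x y) (wt (x ∷ []) *ᴿ when (isBD k a b (suc m) (y ∷ ys)) (wt (y ∷ ys)))
    split y ys = begin
      when (isBD k a b (2 + m) (x ∷ y ∷ ys)) (wt (x ∷ y ∷ ys))
        ≡⟨ ≡.trans (≡.cong (λ t → when t (wt (x ∷ y ∷ ys))) (isBD-∷-∷ m x y ys)) (when-∧ (valid x ∧ gapOK k a b x y) _ _) ⟩
      when (valid x ∧ gapOK k a b x y) (when (isBD k a b (suc m) (y ∷ ys)) (wt (x ∷ y ∷ ys)))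
        ≈⟨ when-cong _ (trans (when-cong _ (wt-∷ x (y ∷ ys))) (when-*ˡ _ _ _)) ⟩
      when (valid x ∧ gapOK k a b x y) (wt (x ∷ []) *ᴿ when (isBD k a b (suc m) (y ∷ ys)) (wt (y ∷ ys))) ∎

  tails-part : ∀ {N} m r c → part r c ≤ N → tails N m (part r c) ≈ weight r c *ᴿ Ψ m c
  tails-part zero r c _ = begin
    when (isBD k a b 1 (part r c ∷ [])) (wt (part r c ∷ [])) +ᴿ 0#
      ≈⟨ +-identityʳ _ ⟩
    when (isBD k a b 1 (part r c ∷ [])) (wt (part r c ∷ []))
      ≡⟨ ≡.cong (λ t → when t (wt (part r c ∷ []))) (isBD-singleton r c) ⟩
    when (c ≡ᵇ 0) (wt (part r c ∷ []))
      ≈⟨ lowest c ⟩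
    weight r c *ᴿ Ψ 0 c ∎
    where
    lowest : ∀ c → when (c ≡ᵇ 0) (wt (part r c ∷ [])) ≈ weight r c *ᴿ Ψ 0 c
    lowest zero    = trans (wt-part r 0) (sym (*-identityʳ _))
    lowest (suc c) = sym (zeroʳ _)
  tails-part {N} (suc m) r c x≤N = begin
    tails N (suc m) x
      ≈⟨ tails-suc N m x ⟩
    ∑ (upTo (suc N)) (λ y → when (valid x ∧ gapOK k a b x y) (wt (x ∷ []) *ᴿ tails N m y))
      ≡⟨ ≡.cong (λ t → ∑ (upTo (suc N)) (λ y → when (t ∧ gapOK k a b x y) (wt (x ∷ []) *ᴿ tails N m y))) (valid-part r c) ⟩
    ∑ (upTo (suc N)) (λ y → when (gapOK k a b x y) (wt (x ∷ []) *ᴿ tails N m y))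
      ≈⟨ ∑-gapOK r c _ (s≤s x≤N) (λ y invalid → trans (*-congˡ (tails-invalid N m y invalid)) (zeroʳ _)) ⟩
    ∑ (successors c) (uncurry λ r′ d → wt (x ∷ []) *ᴿ tails N m (part r′ d))
      ≈⟨ ∑-*ˡ (successors c) _ _ ⟩
    wt (x ∷ []) *ᴿ ∑ (successors c) (uncurry λ r′ d → tails N m (part r′ d))
      ≈⟨ *-cong (wt-part r c) (∑-cong-All (All.map
           (λ {(r′ , d)} d<c → tails-part m r′ d (ℕₚ.≤-trans (ℕₚ.<⇒≤ (part-<-index r′ r d<c)) x≤N))
           (successors-below c))) ⟩
    weight r c *ᴿ Ψ (suc m) c ∎
    where x = part r c

module ClosedForm {c ℓ : Level} (R : CommutativeRing c ℓ)
  (a b k : ℕ) .{{_ : NonZero k}} (1≤a : 1 ≤ a) (a<b : a < b) (b≤k : b ≤ k)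
  (u v q : CommutativeRing.Carrier R) where
  open CommutativeRing R renaming (_+_ to _+ᴿ_; _*_ to _*ᴿ_)
  open RingDefs R using (pow; pochk; genSum)
  open Sums R using (∑-zero; ∑-cong-All)
  open Powers R
  open Rearrangements R
  open Parts a b k 1≤a a<b b≤k using (A; B; part)
  open Enumeration R a b k 1≤a a<b b≤k u v q using (weight; successors; successors-below; Ψ; genSum-BDlargest; tails-part)
  open import Relation.Binary.Reasoning.Setoid setoid
  open ≡ using (cong; cong₂)

  Q : Carrier
  Q = pow q k

  P : ℕ → Carrier
  P = pochk k q

  monomial : ℕ → ℕ → ℕ → Carrier
  monomial i j n = pow u i *ᴿ pow v j *ᴿ pow q n

  weight-A-monomial : ∀ c i j n → weight A c *ᴿ monomial i j n ≈ monomial (suc i) j (part A c + n)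
  weight-A-monomial c i j n = trans (xy∙zwt≈xz∙w∙yt _ _ _ _ _) (*-congˡ (sym (pow-+ q (part A c) n)))

  weight-B-monomial : ∀ c i j n → weight B c *ᴿ monomial i j n ≈ monomial i (suc j) (part B c + n)
  weight-B-monomial c i j n = trans (xy∙zwt≈z∙xw∙yt _ _ _ _ _) (*-congˡ (sym (pow-+ q (part B c) n)))

  pow-q-monomial : ∀ m i j n → pow q m *ᴿ monomial i j n ≈ monomial i j (m + n)
  pow-q-monomial m i j n = trans (y∙zwt≈zw∙yt _ _ _ _) (*-congˡ (sym (pow-+ q m n)))

  exponent : ℕ → ℕ → ℕ
  exponent m h = k * (m C 2) + k * (h C 2) + m * a + (b ∸ a) * h

  closed : ℕ → ℕ → Carrier
  closed m h = monomial (m ∸ h) h (exponent m h)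

  suc-C2 : ∀ n → suc n C 2 ≡ n + n C 2
  suc-C2 n = ≡.trans (≡.sym (nCk+nC[k+1]≡[n+1]C[k+1] n 1)) (cong (_+ n C 2) (nC1≡n n))

  exponent-0 : exponent 0 0 ≡ 0
  exponent-0 rewrite ℕₚ.*-zeroʳ k | ℕₚ.*-zeroʳ (b ∸ a) = ≡.refl

  exponent-A : ∀ m h → part A (m + h) + exponent m h ≡ k * h + exponent (suc m) h
  exponent-A m h rewrite suc-C2 m = polynomial-identity k m h a (m C 2) (h C 2) (b ∸ a)
    where
    polynomial-identity : ∀ k m h a cm ch d → a + (m + h) * k + (k * cm + k * ch + m * a + d * h)
                               ≡ k * h + (k * (m + cm) + k * ch + (1 + m) * a + d * h)
    polynomial-identity = solve-∀

  exponent-B : ∀ m h → part B (m + h) + exponent m h ≡ exponent (suc m) (suc h)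
  exponent-B m h rewrite suc-C2 m | suc-C2 h = ≡.trans
    (cong (λ x → x + (m + h) * k + exponent m h) (≡.sym (ℕₚ.m+[n∸m]≡n (ℕₚ.<⇒≤ a<b))))
    (polynomial-identity k m h a (m C 2) (h C 2) (b ∸ a))
    where
    polynomial-identity : ∀ k m h a cm ch d → a + d + (m + h) * k + (k * cm + k * ch + m * a + d * h)
                               ≡ k * (m + cm) + k * (h + ch) + (1 + m) * a + d * (1 + h)
    polynomial-identity = solve-∀

  closed-step-A : ∀ m h → h ≤ m → weight A (m + h) *ᴿ closed m h ≈ pow Q h *ᴿ closed (suc m) h
  closed-step-A m h h≤m = begin
    weight A (m + h) *ᴿ closed m h
      ≈⟨ weight-A-monomial (m + h) (m ∸ h) h (exponent m h) ⟩
    monomial (suc (m ∸ h)) h (part A (m + h) + exponent m h)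
      ≡⟨ cong₂ (λ i n → monomial i h n) (≡.sym (ℕₚ.+-∸-assoc 1 h≤m)) (exponent-A m h) ⟩
    monomial (suc m ∸ h) h (k * h + exponent (suc m) h)
      ≈⟨ pow-q-monomial (k * h) (suc m ∸ h) h (exponent (suc m) h) ⟨
    pow q (k * h) *ᴿ closed (suc m) h
      ≈⟨ *-congʳ (pow-* q k h) ⟨
    pow Q h *ᴿ closed (suc m) h ∎

  closed-step-B : ∀ m h → weight B (m + h) *ᴿ closed m h ≈ closed (suc m) (suc h)
  closed-step-B m h = trans (weight-B-monomial (m + h) (m ∸ h) h (exponent m h))
                            (reflexive (cong (monomial (m ∸ h) (suc h)) (exponent-B m h)))

  Ψ-below : ∀ m c → c < m → Ψ m c ≈ 0#
  Ψ-below (suc m) c c<1+m = trans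
    (∑-cong-All (All.map (λ {(r , d)} d<c → trans (*-congˡ (Ψ-below m d (ℕₚ.<-≤-trans d<c (s≤s⁻¹ c<1+m)))) (zeroʳ _))
                         (successors-below c)))
    (∑-zero (successors c) (λ _ → refl))

  Ψ-above : ∀ m c → m + m < c → Ψ m c ≈ 0#
  Ψ-above zero    (suc c)       _ = refl
  Ψ-above (suc m) (suc zero)    (s≤s ())
  Ψ-above (suc m) (suc (suc c)) 2m+2<c+2 = begin
    weight A (suc c) *ᴿ Ψ m (suc c) +ᴿ (weight B c *ᴿ Ψ m c +ᴿ 0#)
      ≈⟨ +-cong (vanishes A (suc c) (ℕₚ.<-trans 2m<c (ℕₚ.n<1+n c))) (trans (+-identityʳ _) (vanishes B c 2m<c)) ⟩
    0# +ᴿ 0#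
      ≈⟨ +-identityʳ 0# ⟩
    0# ∎
    where
    2m<c : m + m < c
    2m<c = s≤s⁻¹ (s≤s⁻¹ (≡.subst (_< suc (suc c)) (cong suc (ℕₚ.+-suc m m)) 2m+2<c+2))
    vanishes : ∀ r d → m + m < d → weight r d *ᴿ Ψ m d ≈ 0#
    vanishes r d m+m<d = trans (*-congˡ (Ψ-above m _ m+m<d)) (zeroʳ _)

  Ψ-diagonal : ∀ m → Ψ (suc m) (suc m + 0) ≈ weight A (m + 0) *ᴿ Ψ m (m + 0)
  Ψ-diagonal zero    = +-identityʳ _
  Ψ-diagonal (suc m) = trans (+-congˡ (trans (+-identityʳ _) (trans (*-congˡ below) (zeroʳ _)))) (+-identityʳ _)
    where
    below : Ψ (suc m) (m + 0) ≈ 0#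
    below = Ψ-below (suc m) (m + 0) (s≤s (ℕₚ.≤-reflexive (ℕₚ.+-identityʳ m)))

  Ψ-step : ∀ m h → Ψ (suc m) (suc m + suc h) ≈ weight A (m + suc h) *ᴿ Ψ m (m + suc h) +ᴿ weight B (m + h) *ᴿ Ψ m (m + h)
  Ψ-step m h rewrite ℕₚ.+-suc m h = +-congˡ (+-identityʳ _)

  q-pascal : ∀ h r → pow Q h *ᴿ (1# - pow Q r) +ᴿ (1# - pow Q h) ≈ 1# - pow Q (h + r)
  q-pascal h r = trans (x[1-y]+[1-x]≈1-xy (pow Q h) (pow Q r)) (+-congˡ (-‿cong (sym (pow-+ Q h r))))

  1-Q^suc : ℕ → Carrier
  1-Q^suc n = 1# - pow Q (suc n)

  Ψ-closed-form : ∀ m h → h ≤ m → P h *ᴿ P (m ∸ h) *ᴿ Ψ m (m + h) ≈ closed m h *ᴿ P m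
  Ψ-closed-form zero    zero    _ = begin
    1# *ᴿ 1# *ᴿ 1#                          ≈⟨ trans (*-identityʳ _) (*-identityʳ 1#) ⟩
    1#                                      ≈⟨ trans (*-identityʳ _) (*-identityʳ 1#) ⟨
    1# *ᴿ 1# *ᴿ pow q 0                     ≡⟨ cong (λ n → 1# *ᴿ 1# *ᴿ pow q n) (≡.sym exponent-0) ⟩
    closed 0 0                              ≈⟨ *-identityʳ _ ⟨
    closed 0 0 *ᴿ 1#                        ∎
  Ψ-closed-form (suc m) zero    _ = begin
    P 0 *ᴿ (P m *ᴿ 1-Q^suc m) *ᴿ Ψ (suc m) (suc m + 0)
      ≈⟨ *-congˡ (Ψ-diagonal m) ⟩
    P 0 *ᴿ (P m *ᴿ 1-Q^suc m) *ᴿ (weight A (m + 0) *ᴿ Ψ m (m + 0))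
      ≈⟨ x[yz]∙wt≈wz∙xyt _ _ _ _ _ ⟩
    (weight A (m + 0) *ᴿ 1-Q^suc m) *ᴿ (P 0 *ᴿ P m *ᴿ Ψ m (m + 0))
      ≈⟨ *-congˡ (Ψ-closed-form m 0 z≤n) ⟩
    (weight A (m + 0) *ᴿ 1-Q^suc m) *ᴿ (closed m 0 *ᴿ P m)
      ≈⟨ wz∙sy≈ws∙yz _ _ _ _ ⟩
    (weight A (m + 0) *ᴿ closed m 0) *ᴿ P (suc m)
      ≈⟨ *-congʳ (trans (closed-step-A m 0 z≤n) (*-identityˡ _)) ⟩
    closed (suc m) 0 *ᴿ P (suc m) ∎
  Ψ-closed-form (suc m) (suc h) h<1+m with ℕₚ.m≤n⇒m<n∨m≡n (s≤s⁻¹ h<1+m)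
  ... | inj₂ ≡.refl = begin
    (P h *ᴿ 1-Q^suc h) *ᴿ P (h ∸ h) *ᴿ Ψ (suc h) (suc h + suc h)
      ≈⟨ *-congˡ (trans (Ψ-step h h) (trans (+-congʳ top-vanishes) (+-identityˡ _))) ⟩
    (P h *ᴿ 1-Q^suc h) *ᴿ P (h ∸ h) *ᴿ (weight B (h + h) *ᴿ Ψ h (h + h))
      ≈⟨ yz∙x∙wt≈wz∙yxt _ _ _ _ _ ⟩
    (weight B (h + h) *ᴿ 1-Q^suc h) *ᴿ (P h *ᴿ P (h ∸ h) *ᴿ Ψ h (h + h))
      ≈⟨ *-congˡ (Ψ-closed-form h h ℕₚ.≤-refl) ⟩
    (weight B (h + h) *ᴿ 1-Q^suc h) *ᴿ (closed h h *ᴿ P h)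
      ≈⟨ wz∙sy≈ws∙yz _ _ _ _ ⟩
    (weight B (h + h) *ᴿ closed h h) *ᴿ P (suc h)
      ≈⟨ *-congʳ (closed-step-B h h) ⟩
    closed (suc h) (suc h) *ᴿ P (suc h) ∎
    where
    top-vanishes : weight A (h + suc h) *ᴿ Ψ h (h + suc h) ≈ 0#
    top-vanishes = trans (*-congˡ (Ψ-above h (h + suc h) (ℕₚ.+-monoʳ-< h (ℕₚ.n<1+n h)))) (zeroʳ _)
  ... | inj₁ h<m = begin
    P (suc h) *ᴿ P (m ∸ h) *ᴿ Ψ (suc m) (suc m + suc h)
      ≡⟨ cong (λ n → P (suc h) *ᴿ P n *ᴿ Ψ (suc m) (suc m + suc h)) m∸h≡1+r ⟩
    (P h *ᴿ 1-Q^suc h) *ᴿ (P r *ᴿ 1-Q^suc r) *ᴿ Ψ (suc m) (suc m + suc h)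
      ≈⟨ *-congˡ (Ψ-step m h) ⟩
    (P h *ᴿ 1-Q^suc h) *ᴿ (P r *ᴿ 1-Q^suc r) *ᴿ (wA *ᴿ Ψ m (m + suc h) +ᴿ wB *ᴿ Ψ m (m + h))
      ≈⟨ distribute-factors _ _ _ _ _ _ _ _ ⟩
    (wA *ᴿ 1-Q^suc r) *ᴿ (P (suc h) *ᴿ P r *ᴿ Ψ m (m + suc h)) +ᴿ (wB *ᴿ 1-Q^suc h) *ᴿ (P h *ᴿ P (suc r) *ᴿ Ψ m (m + h))
      ≈⟨ +-cong (*-congˡ (Ψ-closed-form m (suc h) h<m))
                (*-congˡ (trans (reflexive (cong (λ n → P h *ᴿ P n *ᴿ Ψ m (m + h)) (≡.sym m∸h≡1+r)))
                                (Ψ-closed-form m h (ℕₚ.<⇒≤ h<m)))) ⟩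
    (wA *ᴿ 1-Q^suc r) *ᴿ (closed m (suc h) *ᴿ P m) +ᴿ (wB *ᴿ 1-Q^suc h) *ᴿ (closed m h *ᴿ P m)
      ≈⟨ +-cong (wz∙sy≈ws∙yz _ _ _ _) (wz∙sy≈ws∙yz _ _ _ _) ⟩
    (wA *ᴿ closed m (suc h)) *ᴿ (P m *ᴿ 1-Q^suc r) +ᴿ (wB *ᴿ closed m h) *ᴿ (P m *ᴿ 1-Q^suc h)
      ≈⟨ +-cong (*-congʳ (closed-step-A m (suc h) h<m)) (*-congʳ (closed-step-B m h)) ⟩
    (pow Q (suc h) *ᴿ closed (suc m) (suc h)) *ᴿ (P m *ᴿ 1-Q^suc r) +ᴿ closed (suc m) (suc h) *ᴿ (P m *ᴿ 1-Q^suc h)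
      ≈⟨ xy∙zw+y∙zt≈yz∙[xw+t] _ _ _ _ _ ⟩
    closed (suc m) (suc h) *ᴿ P m *ᴿ (pow Q (suc h) *ᴿ 1-Q^suc r +ᴿ 1-Q^suc h)
      ≈⟨ *-congˡ (trans (q-pascal (suc h) (suc r)) (reflexive (cong (λ n → 1# - pow Q n) 1+h+1+r≡1+m))) ⟩
    closed (suc m) (suc h) *ᴿ P m *ᴿ 1-Q^suc m
      ≈⟨ *-assoc _ _ _ ⟩
    closed (suc m) (suc h) *ᴿ P (suc m) ∎
    where
    r  = m ∸ suc h
    wA = weight A (m + suc h)
    wB = weight B (m + h)
    m∸h≡1+r : m ∸ h ≡ suc r
    m∸h≡1+r = ℕₚ.+-∸-assoc 1 h<m
    1+h+1+r≡1+m : suc h + suc r ≡ suc m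
    1+h+1+r≡1+m = ≡.trans (ℕₚ.+-suc (suc h) r) (cong suc (ℕₚ.m+[n∸m]≡n h<m))

  BDlargest-closed-form : ∀ r m h → h ≤ m →
    P h *ᴿ P (m ∸ h) *ᴿ genSum k a b u v q (BDlargest k a b (suc m) (part r (m + h))) ≈ weight r (m + h) *ᴿ closed m h *ᴿ P m
  BDlargest-closed-form r m h h≤m = begin
    P h *ᴿ P (m ∸ h) *ᴿ genSum k a b u v q (BDlargest k a b (suc m) (part r (m + h)))
      ≈⟨ *-congˡ (trans (genSum-BDlargest m _) (tails-part m r (m + h) ℕₚ.≤-refl)) ⟩
    P h *ᴿ P (m ∸ h) *ᴿ (weight r (m + h) *ᴿ Ψ m (m + h))
      ≈⟨ xy∙zt≈z∙xyt _ _ _ _ ⟩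
    weight r (m + h) *ᴿ (P h *ᴿ P (m ∸ h) *ᴿ Ψ m (m + h))
      ≈⟨ *-congˡ (Ψ-closed-form m h h≤m) ⟩
    weight r (m + h) *ᴿ (closed m h *ᴿ P m)
      ≈⟨ *-assoc _ _ _ ⟨
    weight r (m + h) *ᴿ closed m h *ᴿ P m ∎

  largest-part : ∀ m h x → k * h + k * m + x ≡ x + (m + h) * k
  largest-part m h x = polynomial-identity k h m x
    where
    polynomial-identity : ∀ k h m x → k * h + k * m + x ≡ x + (m + h) * k
    polynomial-identity = solve-∀

  BD-generating-function-A : ∀ {m h} → h ≤ m →
    P h *ᴿ P (m ∸ h) *ᴿ genSum k a b u v q (BDlargest k a b (suc m) (k * h + k * m + a))
      ≈ pow u (suc m ∸ h) *ᴿ pow v h *ᴿ pow q (k * (suc m C 2) + k * (suc h C 2) + suc m * a + (b ∸ a) * h) *ᴿ P m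
  BD-generating-function-A {m} {h} h≤m = begin
    P h *ᴿ P (m ∸ h) *ᴿ genSum k a b u v q (BDlargest k a b (suc m) (k * h + k * m + a))
      ≡⟨ cong (λ L → P h *ᴿ P (m ∸ h) *ᴿ genSum k a b u v q (BDlargest k a b (suc m) L)) (largest-part m h a) ⟩
    P h *ᴿ P (m ∸ h) *ᴿ genSum k a b u v q (BDlargest k a b (suc m) (part A (m + h)))
      ≈⟨ BDlargest-closed-form A m h h≤m ⟩
    weight A (m + h) *ᴿ closed m h *ᴿ P m
      ≈⟨ *-congʳ (trans (closed-step-A m h h≤m)
           (trans (*-congʳ (pow-* q k h)) (pow-q-monomial (k * h) (suc m ∸ h) h (exponent (suc m) h)))) ⟩
    monomial (suc m ∸ h) h (k * h + exponent (suc m) h) *ᴿ P m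
      ≡⟨ cong (λ n → monomial (suc m ∸ h) h n *ᴿ P m) exponents-agree ⟩
    pow u (suc m ∸ h) *ᴿ pow v h *ᴿ pow q (k * (suc m C 2) + k * (suc h C 2) + suc m * a + (b ∸ a) * h) *ᴿ P m ∎
    where
    exponents-agree : k * h + exponent (suc m) h ≡ k * (suc m C 2) + k * (suc h C 2) + suc m * a + (b ∸ a) * h
    exponents-agree rewrite suc-C2 h = polynomial-identity k h (suc m C 2) (h C 2) (suc m * a) ((b ∸ a) * h)
      where
      polynomial-identity : ∀ k h cm ch x y → k * h + (k * cm + k * ch + x + y) ≡ k * cm + k * (h + ch) + x + y
      polynomial-identity = solve-∀

  BD-generating-function-B : ∀ {m h} → h ≤ m →
    P h *ᴿ P (m ∸ h) *ᴿ genSum k a b u v q (BDlargest k a b (suc m) (k * h + k * m + b))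
      ≈ pow u (suc m ∸ h ∸ 1) *ᴿ pow v (suc h) *ᴿ pow q (k * (suc m C 2) + k * (suc h C 2) + suc m * a + (b ∸ a) * suc h) *ᴿ P m
  BD-generating-function-B {m} {h} h≤m = begin
    P h *ᴿ P (m ∸ h) *ᴿ genSum k a b u v q (BDlargest k a b (suc m) (k * h + k * m + b))
      ≡⟨ cong (λ L → P h *ᴿ P (m ∸ h) *ᴿ genSum k a b u v q (BDlargest k a b (suc m) L)) (largest-part m h b) ⟩
    P h *ᴿ P (m ∸ h) *ᴿ genSum k a b u v q (BDlargest k a b (suc m) (part B (m + h)))
      ≈⟨ BDlargest-closed-form B m h h≤m ⟩
    weight B (m + h) *ᴿ closed m h *ᴿ P m
      ≈⟨ *-congʳ (closed-step-B m h) ⟩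
    closed (suc m) (suc h) *ᴿ P m
      ≡⟨ cong (λ i → monomial i (suc h) (exponent (suc m) (suc h)) *ᴿ P m)
              (≡.sym (≡.trans (ℕₚ.∸-+-assoc (suc m) h 1) (cong (suc m ∸_) (ℕₚ.+-comm h 1)))) ⟩
    pow u (suc m ∸ h ∸ 1) *ᴿ pow v (suc h) *ᴿ pow q (k * (suc m C 2) + k * (suc h C 2) + suc m * a + (b ∸ a) * suc h) *ᴿ P m ∎

mainTheorem14 : {c ℓ : Level} (R : CommutativeRing c ℓ)
  (a b k : ℕ) .{{_ : NonZero k}} → 1 ≤ a → a < b → b ≤ k →
  (m h : ℕ) → 1 ≤ m → h ≤ m ∸ 1 →
  (u v q : CommutativeRing.Carrier R) →
  let open CommutativeRing R using (_≈_) renaming (_*_ to _*ᴿ_)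
      open RingDefs R
      E = k * (m C 2) + k * ((h + 1) C 2) + m * a
  in (pochk k q h *ᴿ pochk k q (m ∸ 1 ∸ h)
        *ᴿ genSum k a b u v q (BDlargest k a b m (k * h + k * (m ∸ 1) + a))
      ≈ pow u (m ∸ h) *ᴿ pow v h *ᴿ pow q (E + (b ∸ a) * h) *ᴿ pochk k q (m ∸ 1))
   × (pochk k q h *ᴿ pochk k q (m ∸ 1 ∸ h)
        *ᴿ genSum k a b u v q (BDlargest k a b m (k * h + k * (m ∸ 1) + b))
      ≈ pow u (m ∸ h ∸ 1) *ᴿ pow v (h + 1) *ᴿ pow q (E + (b ∸ a) * (h + 1)) *ᴿ pochk k q (m ∸ 1))
mainTheorem14 R a b k 1≤a a<b b≤k (suc m) h (s≤s z≤n) h≤m u v q rewrite ℕₚ.+-comm h 1 =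
  BD-generating-function-A h≤m , BD-generating-function-B h≤m
  where open ClosedForm R a b k 1≤a a<b b≤k u v q
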